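{- Let $s\ge 2$. The parameterized problem $s$-Multiway Cut[local solution] does not admit a boundaried kernelization (of any computable size $f$), when gluing equivalence is required with respect to all glued annotated boundaried graphs $(H_B,T_H)$ with $T_H\subseteq V(H)$ arbitrary (in particular, $T_H$ may contain boundary vertices).
   Context: All graphs are finite, simple, undirected. A boundaried graph $G_B$ is a graph $G$ with a set $B\subseteq V(G)$ (the boundary). For boundaried graphs $G_B,H_B$ with $V(G)\cap V(H)=B$, the glued graph $G_B\oplus H_B$ has vertex set $V(G)\cup V(H)$ and edge set $E(G)\cup E(H)$; for annotated boundaried graphs $(G_B,T_G)$, $(H_B,T_H)$ with $T_G\subseteq V(G)$, $T_H\subseteq V(H)$, the gluing is $(G_B\oplus H_B,T_G\cup T_H)$. $s$-Multiway Cut ($s$ a fixed constant) is the minimization problem: given a graph $G$ and terminal set $T\subseteq V(G)$, a feasible solution is a set $S\subseteq V(G)\setminus T$ such that $|T|\le s$ and $G-S$ contains no path between two distinct vertices of $T$; its value is $|S|$; $\mathrm{OPT}=+\infty$ if there is no feasible solution. Two annotated boundaried graphs $(G_B,T_G)$, $(G'_B,T'_G)$ are gluing equivalent if there is $\Delta\in\mathbb Z$ such that for every admissible $(H_B,T_H)$ (with $V(H)\cap V(G)=V(H)\cap V(G')=B$), $\mathrm{OPT}(G_B\oplus H_B,T_G\cup T_H)=\mathrm{OPT}(G'_B\oplus H_B,T'_G\cup T_H)+\Delta$. A boundaried kernelization for $s$-Multiway Cut[local solution] of size $f$ is a polynomial-time algorithm that, given an annotated boundaried graph $(G_B,T_G)$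 together with a feasible $s$-Multiway Cut solution for $(G,T_G)$ of value $\ell$, outputs a gluing equivalent annotated boundaried graph $(G'_B,T'_G)$ of size at most $f(|B|+\ell)$, together with the offset $\Delta$, where $f$ is a computable function. -}

module Defs where

open import Data.Nat using (ℕ; _+_; _≤_)
open import Data.Integer as ℤ using (ℤ; +_)
open import Data.List using (List; length; _++_)
open import Data.List.Membership.Propositional using (_∈_; _∉_)
open import Data.List.Relation.Unary.All using (All)
open import Data.List.Relation.Unary.Unique.Propositional using (Unique)
open import Data.Maybe using (Maybe; just; nothing)
open import Data.Product using (Σ; _×_; _,_; proj₁; proj₂)
open import Data.Sum using (_⊎_)
open import Data.Unit using (⊤)
open import Data.Empty using (⊥)
open import Relation.Nullary using (¬_)
open import Relation.Binary.PropositionalEquality using (_≡_; _≢_)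

-- A graph: vertices are natural-number labels; edges are listed pairs
-- (undirected reading: (u , v) stands for the edge {u , v}).
record Graph : Set where
  constructor graph
  field
    V : List ℕ
    E : List (ℕ × ℕ)
open Graph public

WFGraph : Graph → Set
WFGraph G = Unique (V G) × All (λ e → (proj₁ e ∈ V G) × (proj₂ e ∈ V G) × (proj₁ e ≢ proj₂ e)) (E G)

size : Graph → ℕ
size G = length (V G) + length (E G)

_⊆ˡ_ : List ℕ → List ℕ → Set
X ⊆ˡ Y = ∀ {x} → x ∈ X → x ∈ Y

record ABGraph : Set where
  constructor abg
  field
    gr   : Graph
    bd   : List ℕ
    term : List ℕ
open ABGraph public

WFABG : ABGraph → Set
WFABG A = WFGraph (gr A) × Unique (bd A) × (bd A ⊆ˡ V (gr A)) × (term A ⊆ˡ V (gr A))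

-- Gluing G_B ⊕ H_B (annotations united).  The vertex set is V(G) ∪ V(H)
-- (as a list, boundary vertices may be listed twice; only membership matters).
glue : ABGraph → ABGraph → ABGraph
glue A C = abg (graph (V (gr A) ++ V (gr C)) (E (gr A) ++ E (gr C))) (bd A) (term A ++ term C)

Admissible : ABGraph → ABGraph → Set
Admissible A C = WFABG C × (bd C ≡ bd A)
  × (∀ {x} → x ∈ V (gr C) → x ∈ V (gr A) → x ∈ bd A)

Adj : Graph → ℕ → ℕ → Set
Adj G u w = ((u , w) ∈ E G) ⊎ ((w , u) ∈ E G)

data Walk (G : Graph) (S : List ℕ) : ℕ → ℕ → Set where
  here : ∀ {u} → u ∈ V G → u ∉ S → Walk G S u u
  step : ∀ {u w v} → u ∉ S → Adj G u w → Walk G S w v → Walk G S u v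

-- |T| ≤ s, counting distinct elements.
CardLe : List ℕ → ℕ → Set
CardLe T s = Σ (List ℕ) λ L → Unique L × (T ⊆ˡ L) × (length L ≤ s)

Feasible : ℕ → Graph → List ℕ → List ℕ → Set
Feasible s G T S = Unique S × (S ⊆ˡ V G) × (∀ {x} → x ∈ S → x ∉ T) × CardLe T s
  × (∀ {t₁ t₂} → t₁ ∈ T → t₂ ∈ T → t₁ ≢ t₂ → ¬ Walk G S t₁ t₂)

-- OptIs s G T o : OPT(G,T) = o, where nothing encodes +∞.
OptIs : ℕ → Graph → List ℕ → Maybe ℕ → Set
OptIs s G T (just k) = (Σ (List ℕ) λ S → Feasible s G T S × length S ≡ k)
  × (∀ S → Feasible s G T S → k ≤ length S)
OptIs s G T nothing = ∀ S → ¬ Feasible s G T S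

OffsetRel : ℤ → Maybe ℕ → Maybe ℕ → Set
OffsetRel Δ (just k) (just k') = + k ≡ (+ k') ℤ.+ Δ
OffsetRel Δ nothing nothing = ⊤
OffsetRel Δ (just _) nothing = ⊥
OffsetRel Δ nothing (just _) = ⊥

GluingEquiv : ℕ → ABGraph → ABGraph → Set
GluingEquiv s A A' = Σ ℤ λ Δ → ∀ C → Admissible A C → Admissible A' C →
  ∀ o o' → OptIs s (gr (glue A C)) (term (glue A C)) o
         → OptIs s (gr (glue A' C)) (term (glue A' C)) o'
         → OffsetRel Δ o o'

-- Let Θ_k be the graph on boundary {0, 1} made of k internally disjoint paths 0 – m – 1,
-- with no terminals; ∅ is a local solution of value 0.  Gluing the edgeless graph on {0, 1}
-- with terminals {0, 1} gives OPT = k, since every middle vertex must be cut, whereas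
-- gluing it without terminals gives OPT = 0.  A gluing equivalent (G', T') must reproduce
-- this difference k for the same offset Δ, but with terminals {0, 1} its optimum is at most
-- |V(G')|.  So |V(G')| ≥ k, and k = f(2) + 1 defeats any size bound f.
module Submission where

open import Defs
open import Data.Nat using (ℕ; suc; _+_; _≤_; _<_; _≤?_; z≤n; s≤s)
open import Data.Nat.Properties
  using (≤-trans; ≤-reflexive; m≤m+n; ≮⇒≥; 1+n≰n; +-cancelˡ-≡; +-identityʳ)
open import Data.Nat.Induction using (<-rec)
open import Data.Integer as ℤ using (ℤ; +_)
import Data.Integer.Properties as ℤ
open import Data.List using (List; []; _∷_; length; map; upTo)
open import Data.List.Properties using (length-removeAt′; length-map; length-upTo)
open import Data.List.Relation.Unary.Any using (here; there; _─_)
open import Data.List.Relation.Unary.Any.Properties using (++⁺ˡ; ++⁻)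
open import Data.List.Relation.Unary.All as All using ([]; _∷_)
open import Data.List.Relation.Unary.All.Properties using (¬Any⇒All¬)
open import Data.List.Relation.Unary.AllPairs using ([]; _∷_)
open import Data.List.Relation.Unary.Unique.Propositional using (Unique)
import Data.List.Relation.Unary.Unique.Propositional.Properties as Unique
open import Data.List.Membership.Propositional using (_∈_; _∉_)
open import Data.List.Membership.Propositional.Properties using (∈-map⁻)
open import Data.List.Membership.DecPropositional Data.Nat._≟_ using (_∈?_)
open import Data.Maybe using (Maybe; just; nothing)
open import Data.Product using (Σ; ∃; _×_; _,_; proj₁; proj₂)
open import Data.Sum using (_⊎_; inj₁; inj₂; [_,_]; swap)
open import Data.Empty using (⊥-elim)
open import Function using (_∘_; id)
open import Relation.Nullary using (¬_; yes; no)
open import Relation.Nullary.Decidable using (¬¬-excluded-middle; decidable-stable)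
open import Relation.Binary.PropositionalEquality
  using (_≡_; _≢_; refl; sym; trans; cong; subst; module ≡-Reasoning)

∈-─ : ∀ {x y : ℕ} {ys} (x∈ys : x ∈ ys) → y ∈ ys → y ≢ x → y ∈ (ys ─ x∈ys)
∈-─ (here refl)  (here refl)  y≢x = ⊥-elim (y≢x refl)
∈-─ (here refl)  (there y∈ys) _   = y∈ys
∈-─ (there _)    (here y≡z)   _   = here y≡z
∈-─ (there x∈ys) (there y∈ys) y≢x = there (∈-─ x∈ys y∈ys y≢x)

unique∧⊆⇒length≤ : ∀ {xs ys : List ℕ} → Unique xs → xs ⊆ˡ ys → length xs ≤ length ys
unique∧⊆⇒length≤ {[]}     _                     _     = z≤n
unique∧⊆⇒length≤ {x ∷ xs} {ys} (x∉xs ∷ xs-unique) xs⊆ys =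
  subst (suc (length xs) ≤_) (sym (length-removeAt′ ys _))
    (s≤s (unique∧⊆⇒length≤ xs-unique λ y∈xs →
      ∈-─ x∈ys (xs⊆ys (there y∈xs)) (λ y≡x → All.lookup x∉xs y∈xs (sym y≡x))))
  where
  x∈ys : x ∈ ys
  x∈ys = xs⊆ys (here refl)

Least : (ℕ → Set) → Set
Least P = Σ ℕ λ k → P k × (∀ j → P j → k ≤ j)

¬¬-least : ∀ {P : ℕ → Set} n → P n → ¬ ¬ Least P
¬¬-least {P} = <-rec (λ n → P n → ¬ ¬ Least P) descend
  where
  descend : ∀ n → (∀ {m} → m < n → P m → ¬ ¬ Least P) → P n → ¬ ¬ Least P
  descend n smaller pn noLeast = ¬¬-excluded-middle {A = Σ ℕ λ m → m < n × P m} λ where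
    (yes (m , m<n , pm)) → smaller m<n pm noLeast
    (no none) → noLeast (n , pn , λ j pj → ≮⇒≥ λ j<n → none (j , j<n , pj))

¬¬-optimum : ∀ s G T → ¬ ¬ Σ (Maybe ℕ) (OptIs s G T)
¬¬-optimum s G T noOpt = ¬¬-excluded-middle {A = Σ (List ℕ) (Feasible s G T)} λ where
  (no infeasible) → noOpt (nothing , λ S feasible → infeasible (S , feasible))
  (yes (S , feasible)) → ¬¬-least (length S) (S , feasible , refl) λ where
    (k , attained , minimal) →
      noOpt (just k , attained , λ S′ feasible′ → minimal _ (S′ , feasible′ , refl))

walk-source-∉ : ∀ {G S u v} → Walk G S u v → u ∉ S
walk-source-∉ (here _ u∉S)   = u∉S
walk-source-∉ (step u∉S _ _) = u∉S

covered-adjacency : ∀ {G S u w} → (∀ {e} → e ∈ E G → proj₁ e ∈ S ⊎ proj₂ e ∈ S) →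
                    Adj G u w → u ∈ S ⊎ w ∈ S
covered-adjacency cover (inj₁ uw) = cover uw
covered-adjacency cover (inj₂ wu) = swap (cover wu)

cover-blocks-walks : ∀ {G S u v} → (∀ {e} → e ∈ E G → proj₁ e ∈ S ⊎ proj₂ e ∈ S) →
                     u ≢ v → ¬ Walk G S u v
cover-blocks-walks cover u≢v (here _ _)          = u≢v refl
cover-blocks-walks {G} cover u≢v (step u∉S adj rest) =
  [ u∉S , walk-source-∉ rest ] (covered-adjacency {G = G} cover adj)

common-neighbour-∈-separator : ∀ {G S u m v} → u ∉ S → v ∉ S → v ∈ V G →
  Adj G u m → Adj G m v → ¬ Walk G S u v → m ∈ S
common-neighbour-∈-separator {S = S} {m = m} u∉S v∉S v∈G um mv separated with m ∈? S
... | yes m∈S = m∈S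
... | no  m∉S = ⊥-elim (separated (step u∉S um (step m∉S mv (here v∈G v∉S))))

feasible-length-≤ : ∀ {s G T S W} → V G ⊆ˡ W → Feasible s G T S → length S ≤ length W
feasible-length-≤ G⊆W (S-unique , S⊆G , _) = unique∧⊆⇒length≤ S-unique (G⊆W ∘ S⊆G)

optimum-≤-vertices : ∀ {s G T k W} → V G ⊆ˡ W → OptIs s G T (just k) → k ≤ length W
optimum-≤-vertices G⊆W ((S , feasible , refl) , _) = feasible-length-≤ G⊆W feasible

no-terminals-feasible : ∀ {s G} → Feasible s G [] []
no-terminals-feasible = [] , (λ ()) , (λ ()) , ([] , [] , (λ ()) , z≤n) , λ ()

optimum-no-terminals : ∀ {s G} → OptIs s G [] (just 0)
optimum-no-terminals = ([] , no-terminals-feasible , refl) , λ _ _ → z≤n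

bareBoundary : List ℕ → List ℕ → ABGraph
bareBoundary B T = abg (graph B []) B T

bareBoundary-admissible : ∀ {A T} → WFABG A → T ⊆ˡ bd A →
                          Admissible A (bareBoundary (bd A) T)
bareBoundary-admissible (_ , B-unique , _ , _) T⊆B =
  ((B-unique , []) , B-unique , id , T⊆B) , refl , λ x∈B _ → x∈B

glue-bareBoundary-vertices : ∀ {A T} → WFABG A →
                             V (gr (glue A (bareBoundary (bd A) T))) ⊆ˡ V (gr A)
glue-bareBoundary-vertices {A} (_ , _ , B⊆G , _) x∈ = [ id , B⊆G ] (++⁻ (V (gr A)) x∈)

offset-difference : ∀ {Δ a b c d} → OffsetRel Δ (just a) (just b) →
                    OffsetRel Δ (just c) (just d) → a + d ≡ b + c
offset-difference {Δ} {a} {b} {c} {d} a≡b+Δ c≡d+Δ = ℤ.+-injective (begin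
  + a ℤ.+ + d           ≡⟨ cong (ℤ._+ + d) a≡b+Δ ⟩
  (+ b ℤ.+ Δ) ℤ.+ + d   ≡⟨ ℤ.+-assoc (+ b) Δ (+ d) ⟩
  + b ℤ.+ (Δ ℤ.+ + d)   ≡⟨ cong (ℤ._+_ (+ b)) (ℤ.+-comm Δ (+ d)) ⟩
  + b ℤ.+ (+ d ℤ.+ Δ)   ≡⟨ cong (ℤ._+_ (+ b)) c≡d+Δ ⟨
  + b ℤ.+ + c           ∎)
  where open ≡-Reasoning

B₀₁ : List ℕ
B₀₁ = 0 ∷ 1 ∷ []

B₀₁-unique : Unique B₀₁
B₀₁-unique = ((λ ()) ∷ []) ∷ [] ∷ []

thetaEdges : List ℕ → List (ℕ × ℕ)
thetaEdges []       = []
thetaEdges (m ∷ ms) = (0 , m) ∷ (m , 1) ∷ thetaEdges ms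

theta : List ℕ → ABGraph
theta ms = abg (graph (0 ∷ 1 ∷ ms) (thetaEdges ms)) B₀₁ []

thetaEdges-spokes : ∀ {ms m} → m ∈ ms → (0 , m) ∈ thetaEdges ms × (m , 1) ∈ thetaEdges ms
thetaEdges-spokes (here refl) = here refl , there (here refl)
thetaEdges-spokes (there m∈ms) with thetaEdges-spokes m∈ms
... | 0m , m1 = there (there 0m) , there (there m1)

thetaEdges-spoke : ∀ {ms e} → e ∈ thetaEdges ms →
                   ∃ λ m → m ∈ ms × (e ≡ (0 , m) ⊎ e ≡ (m , 1))
thetaEdges-spoke {m ∷ _} (here refl)         = m , here refl , inj₁ refl
thetaEdges-spoke {m ∷ _} (there (here refl)) = m , here refl , inj₂ refl
thetaEdges-spoke {_ ∷ _} (there (there e∈)) with thetaEdges-spoke e∈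
... | m , m∈ms , shape = m , there m∈ms , shape

thetaEdges-covered : ∀ {ms e} → e ∈ thetaEdges ms → proj₁ e ∈ ms ⊎ proj₂ e ∈ ms
thetaEdges-covered e∈ with thetaEdges-spoke e∈
... | _ , m∈ms , inj₁ refl = inj₂ m∈ms
... | _ , m∈ms , inj₂ refl = inj₁ m∈ms

module _ {ms : List ℕ} (ms-unique : Unique ms) (0∉ms : 0 ∉ ms) (1∉ms : 1 ∉ ms) where

  theta-wf : WFABG (theta ms)
  theta-wf = (vertices-unique , All.tabulate edge-wf) , B₀₁-unique , B₀₁⊆V , λ ()
    where
    vertices-unique : Unique (0 ∷ 1 ∷ ms)
    vertices-unique = ((λ ()) ∷ ¬Any⇒All¬ ms 0∉ms) ∷ ¬Any⇒All¬ ms 1∉ms ∷ ms-unique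
    B₀₁⊆V : B₀₁ ⊆ˡ (0 ∷ 1 ∷ ms)
    B₀₁⊆V (here refl)         = here refl
    B₀₁⊆V (there (here refl)) = there (here refl)
    edge-wf : ∀ {e} → e ∈ thetaEdges ms →
              proj₁ e ∈ (0 ∷ 1 ∷ ms) × proj₂ e ∈ (0 ∷ 1 ∷ ms) × proj₁ e ≢ proj₂ e
    edge-wf e∈ with thetaEdges-spoke e∈
    ... | _ , m∈ms , inj₁ refl = here refl , there (there m∈ms) , λ { refl → 0∉ms m∈ms }
    ... | _ , m∈ms , inj₂ refl = there (there m∈ms) , there (here refl) , λ { refl → 1∉ms m∈ms }

  theta-optimum-separating : ∀ {s} → 2 ≤ s →
    OptIs s (gr (glue (theta ms) (bareBoundary B₀₁ B₀₁))) B₀₁ (just (length ms))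
  theta-optimum-separating {s} 2≤s = (ms , feasible , refl) , λ S S-feasible →
    unique∧⊆⇒length≤ ms-unique (ms⊆separator S-feasible)
    where
    G : Graph
    G = gr (glue (theta ms) (bareBoundary B₀₁ B₀₁))
    ms∩B₀₁=∅ : ∀ {x} → x ∈ ms → x ∉ B₀₁
    ms∩B₀₁=∅ m∈ms (here refl)         = 0∉ms m∈ms
    ms∩B₀₁=∅ m∈ms (there (here refl)) = 1∉ms m∈ms
    covered : ∀ {e} → e ∈ E G → proj₁ e ∈ ms ⊎ proj₂ e ∈ ms
    covered e∈ = [ thetaEdges-covered , (λ ()) ] (++⁻ (thetaEdges ms) e∈)
    feasible : Feasible s G B₀₁ ms
    feasible = ms-unique , there ∘ there ∘ ++⁺ˡ , ms∩B₀₁=∅ , (B₀₁ , B₀₁-unique , id , 2≤s)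
             , λ _ _ t₁≢t₂ → cover-blocks-walks covered t₁≢t₂
    ms⊆separator : ∀ {S} → Feasible s G B₀₁ S → ms ⊆ˡ S
    ms⊆separator (_ , _ , S∩B₀₁=∅ , _ , separates) m∈ms with thetaEdges-spokes m∈ms
    ... | 0m , m1 =
      common-neighbour-∈-separator (λ 0∈S → S∩B₀₁=∅ 0∈S (here refl))
        (λ 1∈S → S∩B₀₁=∅ 1∈S (there (here refl))) (there (here refl))
        (inj₁ (++⁺ˡ 0m)) (inj₁ (++⁺ˡ m1)) (separates (here refl) (there (here refl)) λ ())

  -- OPT exists only classically, but the goal is decidable, so we may argue under ¬¬.
  theta-equivalent-vertices : ∀ {s A′} → 2 ≤ s → WFABG A′ → bd A′ ≡ B₀₁ →
    GluingEquiv s (theta ms) A′ → length ms ≤ length (V (gr A′))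
  theta-equivalent-vertices {s} {A′@(abg G′ _ _)} 2≤s wf′ refl (Δ , equiv) =
    decidable-stable (length ms ≤? length (V G′)) λ short →
    ¬¬-optimum s _ _ λ (o₁ , opt₁) → ¬¬-optimum s _ _ λ (o₀ , opt₀) →
    short (bound opt₁ (compare id (theta-optimum-separating 2≤s) opt₁)
                      (compare (λ ()) optimum-no-terminals opt₀))
    where
    Glued : ABGraph → List ℕ → ABGraph
    Glued A T = glue A (bareBoundary B₀₁ T)
    compare : ∀ {T o o′} → T ⊆ˡ B₀₁ →
      OptIs s (gr (Glued (theta ms) T)) (term (Glued (theta ms) T)) o →
      OptIs s (gr (Glued A′ T)) (term (Glued A′ T)) o′ → OffsetRel Δ o o′
    compare T⊆B₀₁ opt opt′ = equiv _ (bareBoundary-admissible theta-wf T⊆B₀₁)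
      (bareBoundary-admissible wf′ T⊆B₀₁) _ _ opt opt′
    bound : ∀ {o₁ o₀} → OptIs s (gr (Glued A′ B₀₁)) (term (Glued A′ B₀₁)) o₁ →
      OffsetRel Δ (just (length ms)) o₁ → OffsetRel Δ (just 0) o₀ → length ms ≤ length (V G′)
    bound {just k₁} {just k₀} opt₁ e₁ e₀ =
      ≤-trans |ms|≤k₁ (optimum-≤-vertices (glue-bareBoundary-vertices {T = B₀₁} wf′) opt₁)
      where
      |ms|≤k₁ : length ms ≤ k₁
      |ms|≤k₁ = ≤-trans (m≤m+n (length ms) k₀)
                  (≤-reflexive (trans (offset-difference {Δ} e₁ e₀) (+-identityʳ k₁)))
    bound {nothing} _ () _
    bound {just _} {nothing} _ _ ()

middles : ℕ → List ℕ
middles k = map (suc ∘ suc) (upTo k)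

middles-unique : ∀ k → Unique (middles k)
middles-unique k = Unique.map⁺ (+-cancelˡ-≡ 2 _ _) (Unique.upTo⁺ k)

0∉middles : ∀ k → 0 ∉ middles k
0∉middles k 0∈ with ∈-map⁻ _ 0∈
... | _ , _ , ()

1∉middles : ∀ k → 1 ∉ middles k
1∉middles k 1∈ with ∈-map⁻ _ 1∈
... | _ , _ , ()

length-middles : ∀ k → length (middles k) ≡ k
length-middles k = trans (length-map _ (upTo k)) (length-upTo k)

theorem10 : (s : ℕ) → 2 ≤ s → (f : ℕ → ℕ) →
    Σ ABGraph λ A → WFABG A × Σ (List ℕ) λ S → Feasible s (gr A) (term A) S ×
      ¬ (Σ ABGraph λ A' → WFABG A' × (bd A' ≡ bd A)
           × (size (gr A') ≤ f (length (bd A) + length S))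
           × GluingEquiv s A A')
theorem10 s 2≤s f =
  theta (middles K) , theta-wf (middles-unique K) (0∉middles K) (1∉middles K) ,
  [] , no-terminals-feasible ,
  λ (A′ , wf′ , bd≡ , small , equiv) →
    1+n≰n (≤-trans (large wf′ bd≡ equiv) (≤-trans (m≤m+n _ (length (E (gr A′)))) small))
  where
  K : ℕ
  K = suc (f 2)
  large : ∀ {A′} → WFABG A′ → bd A′ ≡ B₀₁ → GluingEquiv s (theta (middles K)) A′ →
          K ≤ length (V (gr A′))
  large {A′} wf′ bd≡ equiv = subst (_≤ length (V (gr A′))) (length-middles K)
    (theta-equivalent-vertices (middles-unique K) (0∉middles K) (1∉middles K) 2≤s wf′ bd≡ equiv)
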